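{- If $G$ is a unicyclic graph that is not a König–Egerváry graph, with unique cycle $C$, then \[ \mathrm{core}(G)=\bigcup\{\mathrm{core}(T_x): x\in N_1(C)\}. \]
   Context: All graphs are finite, simple and undirected. A graph is unicyclic if it is connected and contains exactly one cycle. $\alpha(G)$ is the maximum cardinality of an independent set (a set of pairwise non-adjacent vertices) of $G$, and $\mu(G)$ is the maximum cardinality of a matching of $G$. A graph $G$ on $n$ vertices is a König–Egerváry graph if $\alpha(G)+\mu(G)=n$. $\mathrm{core}(H)$ is the intersection of all maximum independent sets of a graph $H$. For the unique cycle $C$ of $G$, $N_1(C)=\{v\in V(G)\setminus V(C): v \text{ has a neighbor in } V(C)\}$. For $x\in N_1(C)$ with neighbor $y\in V(C)$, $T_x$ denotes the tree which is the connected component containing $x$ of the graph $G-xy$ obtained by deleting the edge $xy$. -}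

module Defs where

open import Data.Nat using (ℕ; _+_; _≤_)
open import Data.Bool using (Bool; true; false; _∧_; _∨_; not)
open import Data.Fin using (Fin; _≟_)
open import Data.Fin.Subset using (Subset; _∈_; ∣_∣)
open import Data.List using (List; []; _∷_; _++_; length; concatMap)
open import Data.List.Relation.Unary.All using (All)
open import Data.List.Relation.Unary.Any using (Any)
open import Data.List.Relation.Unary.Unique.Propositional using (Unique)
open import Data.Product using (Σ; _×_; _,_; proj₁; proj₂)
open import Data.Sum using (_⊎_)
open import Data.Unit using (⊤)
open import Relation.Binary.PropositionalEquality using (_≡_; _≢_)
open import Relation.Nullary using (¬_)
open import Relation.Nullary.Decidable using (⌊_⌋)

record Graph (n : ℕ) : Set where
  field
    adj    : Fin n → Fin n → Bool
    sym    : ∀ u v → adj u v ≡ adj v u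
    irrefl : ∀ v → adj v v ≡ false
open Graph public

-- A "vertex-restricted graph": vertex set W ⊆ Fin n (a predicate) and an
-- adjacency relation A.  Used to speak about G itself (W = everything) and
-- about the trees T_x (W = component of x in G - xy, A = adjacency of G - xy).

IsIndep : ∀ {n} → (Fin n → Set) → (Fin n → Fin n → Bool) → Subset n → Set
IsIndep W A S = (∀ v → v ∈ S → W v) × (∀ u v → u ∈ S → v ∈ S → A u v ≡ false)

IsMaxIndep : ∀ {n} → (Fin n → Set) → (Fin n → Fin n → Bool) → Subset n → Set
IsMaxIndep W A S = IsIndep W A S × (∀ T → IsIndep W A T → ∣ T ∣ ≤ ∣ S ∣)

InCore : ∀ {n} → (Fin n → Set) → (Fin n → Fin n → Bool) → Fin n → Set
InCore W A v = ∀ S → IsMaxIndep W A S → v ∈ S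

allV : ∀ {n} → Fin n → Set
allV _ = ⊤

IsAlpha : ∀ {n} → Graph n → ℕ → Set
IsAlpha G a = Σ (Subset _) λ S → IsMaxIndep allV (adj G) S × ∣ S ∣ ≡ a

endpoints : ∀ {n} → List (Fin n × Fin n) → List (Fin n)
endpoints = concatMap (λ p → proj₁ p ∷ proj₂ p ∷ [])

IsMatching : ∀ {n} → Graph n → List (Fin n × Fin n) → Set
IsMatching G M = All (λ p → adj G (proj₁ p) (proj₂ p) ≡ true) M × Unique (endpoints M)

IsMu : ∀ {n} → Graph n → ℕ → Set
IsMu G m = Σ (List _) λ M → IsMatching G M × length M ≡ m
         × (∀ M' → IsMatching G M' → length M' ≤ length M)

IsKE : ∀ {n} → Graph n → Set
IsKE {n} G = Σ ℕ λ a → Σ ℕ λ m → IsAlpha G a × IsMu G m × a + m ≡ n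

data Reach {n} (A : Fin n → Fin n → Bool) (x : Fin n) : Fin n → Set where
  here : Reach A x x
  step : ∀ {u w} → Reach A x u → A u w ≡ true → Reach A x w

Connected : ∀ {n} → Graph n → Set
Connected G = ∀ u v → Reach (adj G) u v

data Consec {A : Set} : List A → A → A → Set where
  here  : ∀ {a b l} → Consec (a ∷ b ∷ l) a b
  there : ∀ {x a b l} → Consec l a b → Consec (x ∷ l) a b

close : {A : Set} → List A → List A
close []      = []
close (a ∷ l) = a ∷ l ++ a ∷ []

CycEdge : ∀ {n} → List (Fin n) → Fin n → Fin n → Set
CycEdge c u v = Consec (close c) u v ⊎ Consec (close c) v u

IsCycle : ∀ {n} → Graph n → List (Fin n) → Set
IsCycle G c = 3 ≤ length c × Unique c × (∀ u v → Consec (close c) u v → adj G u v ≡ true)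

SameCycle : ∀ {n} → List (Fin n) → List (Fin n) → Set
SameCycle c d = ∀ u v → (CycEdge c u v → CycEdge d u v) × (CycEdge d u v → CycEdge c u v)

Unicyclic : ∀ {n} → Graph n → Set
Unicyclic G = Connected G × Σ (List _) (IsCycle G)
            × (∀ c d → IsCycle G c → IsCycle G d → SameCycle c d)

OnCycle : ∀ {n} → List (Fin n) → Fin n → Set
OnCycle c v = Any (v ≡_) c

InN1 : ∀ {n} → Graph n → List (Fin n) → Fin n → Set
InN1 G c x = ¬ OnCycle c x × Σ (Fin _) λ y → OnCycle c y × adj G x y ≡ true

deleteEdge : ∀ {n} → (Fin n → Fin n → Bool) → Fin n → Fin n → Fin n → Fin n → Bool
deleteEdge A x y u v =
  A u v ∧ not ((⌊ u ≟ x ⌋ ∧ ⌊ v ≟ y ⌋) ∨ (⌊ u ≟ y ⌋ ∧ ⌊ v ≟ x ⌋))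

TxV : ∀ {n} → Graph n → Fin n → Fin n → Fin n → Set
TxV G x y = Reach (deleteEdge (adj G) x y) x

TxA : ∀ {n} → Graph n → Fin n → Fin n → Fin n → Fin n → Bool
TxA G x y = deleteEdge (adj G) x y

-- (1) Weak duality |S| + |M| ≤ n holds for every independent set S and
--     matching M, so a pair with n ≤ |S| + |M| (a certificate) proves G is
--     König–Egerváry.  Forests have certificates, by removing leaves.
-- (2) For a cycle edge yy′ the graph G − yy′ is a forest.  Its certificate
--     (R , M) is not one for G, which forces y ∈ R and makes R − y a maximum
--     independent set of G avoiding y and the off-cycle neighbours of y.
--     So no cycle vertex lies in core(G).
-- (3) The only edge leaving T_x is the bridge xy, so (S ─ T_x) ∪ T is
--     independent unless y ∈ S and x ∈ T.  Together with the set from (2)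
--     this makes traces on T_x of maximum sets of G maximum in T_x, and lets
--     every maximum set of T_x be glued into one of G: core(T_x) = core(G) ∩ T_x.
-- (4) Every vertex off C lies in some T_x, which gives the theorem.
module Submission where

open import Defs hiding (sym)
open import Data.Nat using (ℕ; zero; suc; _+_; _∸_; _≤_; _<_; z≤n; s≤s)
open import Data.Nat.Properties
  using (+-suc; +-comm; +-identityʳ; +-monoˡ-≤; +-monoʳ-≤; +-cancelˡ-≤; +-cancelʳ-≤; m+[n∸m]≡n;
         ≤-trans; ≤-reflexive; ≤-antisym; ≤-pred; m≤n⇒m≤1+n; m≤m+n; <⇒≱; ≰⇒>; <-irrefl;
         module ≤-Reasoning)
open import Data.Bool using (Bool; true; false; _∧_; _∨_; not)
open import Data.Bool.Properties
  using (∧-conicalˡ; ∧-zeroʳ; ∧-identityʳ; ∧-comm; ∨-comm; ¬-not) renaming (_≟_ to _≟ᵇ_)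
open import Data.Fin using (Fin; zero; suc; _≟_)
open import Data.Fin.Properties using (any?)
open import Data.Fin.Subset
  using (Subset; inside; outside; _∈_; _∉_; _⊆_; ∣_∣; _∩_; _∪_; _─_; _-_; ⁅_⁆; ∁)
  renaming (⊤ to full)
open import Data.Fin.Subset.Properties
  using (_∈?_; ∈⊤; x∈⁅x⁆; x∈⁅y⁆⇒x≡y; x≢y⇒x∉⁅y⁆; x∉⁅y⁆⇒x≢y; x∈p∪q⁻; x∈p∪q⁺; x∈p∩q⁻;
         x∈p∧x∉q⇒x∈p─q; x∉p⇒x∈∁p; p─q⊆p; p∩q⊆p; p─⊥≡p; ∣⊤∣≡n; ∣⁅x⁆∣≡1; ∣p∣≤n;
         ∣p∩q∣≤∣q∣; ∣p∣≤∣p∪q∣; ∣∁p∣≡n∸∣p∣; p⊂q⇒∣p∣<∣q∣)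
open import Data.Vec using (tabulate; []; _∷_; here; there)
open import Data.Vec.Properties using (lookup∘tabulate; []=⇒lookup; lookup⇒[]=)
open import Data.List using (List; []; _∷_; _++_; length)
open import Data.List.Relation.Unary.Any as Any using (Any; here; there)
open import Data.List.Relation.Unary.All.Properties.Core using (¬Any⇒All¬)
open import Data.List.Relation.Unary.All.Properties using (++⁻ˡ)
open import Data.List.Relation.Unary.Any.Properties using (++⁻)
open import Data.List.Relation.Unary.All using (All; []; _∷_)
import Data.List.Relation.Unary.All as All
open import Data.List.Relation.Unary.Unique.Propositional using (Unique; []; _∷_)
open import Data.Empty using (⊥-elim)
open import Data.Product using (Σ; _×_; _,_; proj₁; proj₂)
open import Data.Sum using (_⊎_; inj₁; inj₂; [_,_])
open import Data.Unit using (tt)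
open import Function using (_∘_)
open import Relation.Nullary using (Dec; yes; no; ¬_; ¬?; _×-dec_)
open import Relation.Nullary.Decidable using (does; ⌊_⌋; map′; dec-true)
open import Relation.Unary using (Decidable)
open import Induction.WellFounded using (Acc; acc)
open import Data.Nat.Induction using (<-wellFounded)
open import Relation.Binary.PropositionalEquality
  using (_≡_; _≢_; refl; sym; trans; cong; cong₂; subst)

∣p∣≡∣p∩q∣+∣p─q∣ : ∀ {n} (p q : Subset n) → ∣ p ∣ ≡ ∣ p ∩ q ∣ + ∣ p ─ q ∣
∣p∣≡∣p∩q∣+∣p─q∣ []            []            = refl
∣p∣≡∣p∩q∣+∣p─q∣ (inside  ∷ p) (inside  ∷ q) = cong suc (∣p∣≡∣p∩q∣+∣p─q∣ p q)
∣p∣≡∣p∩q∣+∣p─q∣ (inside  ∷ p) (outside ∷ q) =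
  trans (cong suc (∣p∣≡∣p∩q∣+∣p─q∣ p q)) (sym (+-suc _ _))
∣p∣≡∣p∩q∣+∣p─q∣ (outside ∷ p) (inside  ∷ q) = ∣p∣≡∣p∩q∣+∣p─q∣ p q
∣p∣≡∣p∩q∣+∣p─q∣ (outside ∷ p) (outside ∷ q) = ∣p∣≡∣p∩q∣+∣p─q∣ p q

∣p∪q∣≡∣p∣+∣q∣ : ∀ {n} (p q : Subset n) → (∀ {x} → x ∈ p → x ∉ q) → ∣ p ∪ q ∣ ≡ ∣ p ∣ + ∣ q ∣
∣p∪q∣≡∣p∣+∣q∣ []            []            _ = refl
∣p∪q∣≡∣p∣+∣q∣ (inside  ∷ p) (inside  ∷ q) d = ⊥-elim (d here here)
∣p∪q∣≡∣p∣+∣q∣ (inside  ∷ p) (outside ∷ q) d =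
  cong suc (∣p∪q∣≡∣p∣+∣q∣ p q (λ x∈p x∈q → d (there x∈p) (there x∈q)))
∣p∪q∣≡∣p∣+∣q∣ (outside ∷ p) (inside  ∷ q) d =
  trans (cong suc (∣p∪q∣≡∣p∣+∣q∣ p q (λ x∈p x∈q → d (there x∈p) (there x∈q)))) (sym (+-suc _ _))
∣p∪q∣≡∣p∣+∣q∣ (outside ∷ p) (outside ∷ q) d =
  ∣p∪q∣≡∣p∣+∣q∣ p q (λ x∈p x∈q → d (there x∈p) (there x∈q))

∣p∣≡1+∣p-x∣ : ∀ {n} {x : Fin n} {p : Subset n} → x ∈ p → ∣ p ∣ ≡ suc ∣ p - x ∣
∣p∣≡1+∣p-x∣ {x = zero}  {inside  ∷ p} here        = cong (λ q → suc ∣ q ∣) (sym (p─⊥≡p p))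
∣p∣≡1+∣p-x∣ {x = suc x} {inside  ∷ p} (there x∈p) = cong suc (∣p∣≡1+∣p-x∣ x∈p)
∣p∣≡1+∣p-x∣ {x = suc x} {outside ∷ p} (there x∈p) = ∣p∣≡1+∣p-x∣ x∈p

∣p∣≤1+∣p-x∣ : ∀ {n} (p : Subset n) (x : Fin n) → ∣ p ∣ ≤ suc ∣ p - x ∣
∣p∣≤1+∣p-x∣ p x = begin
  ∣ p ∣                       ≡⟨ ∣p∣≡∣p∩q∣+∣p─q∣ p ⁅ x ⁆ ⟩
  ∣ p ∩ ⁅ x ⁆ ∣ + ∣ p - x ∣   ≤⟨ +-monoˡ-≤ ∣ p - x ∣ (∣p∩q∣≤∣q∣ p ⁅ x ⁆) ⟩
  ∣ ⁅ x ⁆ ∣ + ∣ p - x ∣       ≡⟨ cong (_+ ∣ p - x ∣) (∣⁅x⁆∣≡1 x) ⟩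
  suc ∣ p - x ∣               ∎
  where open ≤-Reasoning

x∈p─q⇒x∉q : ∀ {n} {x : Fin n} (p q : Subset n) → x ∈ p ─ q → x ∉ q
x∈p─q⇒x∉q (_ ∷ p) (inside  ∷ q) (there x∈) (there x∈q) = x∈p─q⇒x∉q p q x∈ x∈q
x∈p─q⇒x∉q (_ ∷ p) (outside ∷ q) (there x∈) (there x∈q) = x∈p─q⇒x∉q p q x∈ x∈q

∈-remove : ∀ {n} {x y : Fin n} {p : Subset n} → x ∈ p → y ≢ x → x ∈ p - y
∈-remove x∈p y≢x = x∈p∧x∉q⇒x∈p─q x∈p (x≢y⇒x∉⁅y⁆ (λ x≡y → y≢x (sym x≡y)))

unique⊆⇒length≤ : ∀ {n} (p : Subset n) (vs : List (Fin n))
  → Unique vs → All (_∈ p) vs → length vs ≤ ∣ p ∣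
unique⊆⇒length≤ p []       _             _            = z≤n
unique⊆⇒length≤ p (v ∷ vs) (v∉vs ∷ uvs) (v∈p ∷ vs⊆p) = begin
  suc (length vs) ≤⟨ s≤s (unique⊆⇒length≤ (p - v) vs uvs vs⊆p-v) ⟩
  suc ∣ p - v ∣   ≡⟨ sym (∣p∣≡1+∣p-x∣ v∈p) ⟩
  ∣ p ∣           ∎
  where
  open ≤-Reasoning
  vs⊆p-v : All (_∈ p - v) vs
  vs⊆p-v = All.zipWith (λ (v≢w , w∈p) → ∈-remove w∈p v≢w) (v∉vs , vs⊆p)

fromDec : ∀ {n} {P : Fin n → Set} → Decidable P → Subset n
fromDec P? = tabulate (λ v → does (P? v))

∈fromDec⁺ : ∀ {n} {P : Fin n → Set} (P? : Decidable P) {v} → P v → v ∈ fromDec P?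
∈fromDec⁺ P? {v} Pv = lookup⇒[]= v _ (trans (lookup∘tabulate _ v) (dec-true (P? v) Pv))

∈fromDec⁻ : ∀ {n} {P : Fin n → Set} (P? : Decidable P) {v} → v ∈ fromDec P? → P v
∈fromDec⁻ {P = P} P? {v} v∈ =
  witness (P? v) (trans (sym (lookup∘tabulate (λ w → does (P? w)) v)) ([]=⇒lookup v∈))
  where
  witness : (d : Dec (P v)) → does d ≡ true → P v
  witness (yes p) _ = p

adjacent⇒distinct : ∀ {n} (H : Graph n) {u v} → adj H u v ≡ true → u ≢ v
adjacent⇒distinct H {u} uv refl with trans (sym uv) (irrefl H u)
... | ()

Independent : ∀ {n} → (Fin n → Fin n → Bool) → Subset n → Set
Independent A S = ∀ u v → u ∈ S → v ∈ S → A u v ≡ false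

independent⇒no-edge : ∀ {n} {A : Fin n → Fin n → Bool} {S u v}
  → Independent A S → u ∈ S → v ∈ S → A u v ≢ true
independent⇒no-edge {u = u} {v} ind u∈S v∈S uv with trans (sym uv) (ind u v u∈S v∈S)
... | ()

deleteEdge⊆ : ∀ {n} (A : Fin n → Fin n → Bool) x y u v → deleteEdge A x y u v ≡ true → A u v ≡ true
deleteEdge⊆ A x y u v = ∧-conicalˡ (A u v) _

deleteEdge-cases : ∀ {n} (A : Fin n → Fin n → Bool) x y u v → A u v ≡ true
  → deleteEdge A x y u v ≡ true ⊎ (u ≡ x × v ≡ y) ⊎ (u ≡ y × v ≡ x)
deleteEdge-cases A x y u v uv with u ≟ x | v ≟ y | u ≟ y | v ≟ x
... | yes u≡x | yes v≡y | _       | _       = inj₂ (inj₁ (u≡x , v≡y))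
... | _       | _       | yes u≡y | yes v≡x = inj₂ (inj₂ (u≡y , v≡x))
... | yes _   | no _    | yes _   | no _    rewrite uv = inj₁ refl
... | yes _   | no _    | no _    | _       rewrite uv = inj₁ refl
... | no _    | _       | yes _   | no _    rewrite uv = inj₁ refl
... | no _    | _       | no _    | _       rewrite uv = inj₁ refl

deleteEdge-removes : ∀ {n} (A : Fin n → Fin n → Bool) x y → deleteEdge A x y x y ≡ false
deleteEdge-removes A x y with x ≟ x | y ≟ y
... | yes _  | yes _  = ∧-zeroʳ (A x y)
... | no x≢x | _      = ⊥-elim (x≢x refl)
... | _      | no y≢y = ⊥-elim (y≢y refl)

deleteEdgeGraph : ∀ {n} → Graph n → Fin n → Fin n → Graph n
deleteEdgeGraph G x y = record
  { adj    = deleteEdge (adj G) x y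
  ; sym    = λ u v → cong₂ (λ a b → a ∧ not b) (Graph.sym G u v) (pair-sym u v)
  ; irrefl = λ v → cong (_∧ _) (irrefl G v)
  }
  where
  pair-sym : ∀ u v → ((⌊ u ≟ x ⌋ ∧ ⌊ v ≟ y ⌋) ∨ (⌊ u ≟ y ⌋ ∧ ⌊ v ≟ x ⌋))
                   ≡ ((⌊ v ≟ x ⌋ ∧ ⌊ u ≟ y ⌋) ∨ (⌊ v ≟ y ⌋ ∧ ⌊ u ≟ x ⌋))
  pair-sym u v = trans (∨-comm (⌊ u ≟ x ⌋ ∧ ⌊ v ≟ y ⌋) _)
                       (cong₂ _∨_ (∧-comm ⌊ u ≟ y ⌋ _) (∧-comm ⌊ u ≟ x ⌋ _))

isolate : ∀ {n} → (Fin n → Fin n → Bool) → Fin n → Fin n → Fin n → Bool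
isolate A w u v = A u v ∧ not (⌊ u ≟ w ⌋ ∨ ⌊ v ≟ w ⌋)

isolate-edge : ∀ {n} (A : Fin n → Fin n → Bool) w u v
  → isolate A w u v ≡ true → A u v ≡ true × u ≢ w × v ≢ w
isolate-edge A w u v e with u ≟ w | v ≟ w | A u v
isolate-edge A w u v e  | no u≢w | no v≢w | true = refl , u≢w , v≢w
isolate-edge A w u v () | yes _  | _      | true
isolate-edge A w u v () | no _   | yes _  | true
isolate-edge A w u v () | _      | _      | false

isolate-keeps : ∀ {n} (A : Fin n → Fin n → Bool) w u v
  → A u v ≡ true → u ≢ w → v ≢ w → isolate A w u v ≡ true
isolate-keeps A w u v uv u≢w v≢w with u ≟ w | v ≟ w
... | no _    | no _    = trans (∧-identityʳ (A u v)) uv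
... | yes u≡w | _       = ⊥-elim (u≢w u≡w)
... | _       | yes v≡w = ⊥-elim (v≢w v≡w)

isolateGraph : ∀ {n} → Graph n → Fin n → Graph n
isolateGraph G w = record
  { adj    = isolate (adj G) w
  ; sym    = λ u v → cong₂ (λ a b → a ∧ not b) (Graph.sym G u v) (∨-comm ⌊ u ≟ w ⌋ _)
  ; irrefl = λ v → cong (_∧ _) (irrefl G v)
  }

prefix-unique : ∀ {A : Set} (xs : List A) {ys} → Unique (xs ++ ys) → Unique xs
prefix-unique []       _          = []
prefix-unique (x ∷ xs) (x∉ ∷ u) = ++⁻ˡ xs x∉ ∷ prefix-unique xs u

consec-mem : ∀ {A : Set} {l : List A} {a b} → Consec l a b → Any (a ≡_) l × Any (b ≡_) l
consec-mem here      = here refl , there (here refl)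
consec-mem (there c) with consec-mem c
... | a∈ , b∈ = there a∈ , there b∈

close-mem : ∀ {A : Set} (l : List A) {x} → Any (x ≡_) (close l) → Any (x ≡_) l
close-mem (a ∷ l) (here x≡a) = here x≡a
close-mem (a ∷ l) (there x∈) with ++⁻ l x∈
... | inj₁ x∈l        = there x∈l
... | inj₂ (here x≡a) = here x≡a

consec-close-mem : ∀ {A : Set} {l : List A} {a b} → Consec (close l) a b → Any (a ≡_) l × Any (b ≡_) l
consec-close-mem {l = l} c = close-mem l (proj₁ (consec-mem c)) , close-mem l (proj₂ (consec-mem c))

cycle-successor : ∀ {A : Set} (l : List A) {y} → Any (y ≡_) l → Σ A λ y′ → Consec (close l) y y′
cycle-successor (a ∷ l) = successor (a ∷ l)
  where
  successor : ∀ l {y} → Any (y ≡_) l → Σ _ λ y′ → Consec (l ++ a ∷ []) y y′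
  successor (x ∷ [])     (here refl) = a , here
  successor (x ∷ x′ ∷ l) (here refl) = x′ , here
  successor (x ∷ l)      (there y∈) with successor l y∈
  ... | y′ , c = y′ , there c

module _ {n} {A : Fin n → Fin n → Bool} where

  independent-mono : ∀ {S R} → S ⊆ R → Independent A R → Independent A S
  independent-mono S⊆R ind u v u∈ v∈ = ind u v (S⊆R u∈) (S⊆R v∈)

  independent-delete : ∀ {x y S} → Independent A S → Independent (deleteEdge A x y) S
  independent-delete ind u v u∈ v∈ rewrite ind u v u∈ v∈ = refl

  independent-restore : ∀ {x y S} → Independent (deleteEdge A x y) S → x ∉ S ⊎ y ∉ S
    → Independent A S
  independent-restore {x} {y} {S} ind miss u v u∈ v∈ = ¬-not no-edge
    where
    no-edge : A u v ≢ true
    no-edge uv with deleteEdge-cases A x y u v uv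
    ... | inj₁ kept                 = independent⇒no-edge ind u∈ v∈ kept
    ... | inj₂ (inj₁ (refl , refl)) = [ (λ x∉ → x∉ u∈) , (λ y∉ → y∉ v∈) ] miss
    ... | inj₂ (inj₂ (refl , refl)) = [ (λ x∉ → x∉ v∈) , (λ y∉ → y∉ u∈) ] miss

-- Walk A s t vs: a walk from s to t along A-edges, vs lists its vertices
-- from t back to s (so extending the walk conses onto vs).
data Walk {n} (A : Fin n → Fin n → Bool) (s : Fin n) : Fin n → List (Fin n) → Set where
  start : Walk A s s (s ∷ [])
  _▸_   : ∀ {u w vs} → Walk A s u vs → A u w ≡ true → Walk A s w (w ∷ vs)

module _ {n} {A : Fin n → Fin n → Bool} where

  reach⇒walk : ∀ {s t} → Reach A s t → Σ (List (Fin n)) (Walk A s t)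
  reach⇒walk here       = _ , start
  reach⇒walk (step r e) = _ , proj₂ (reach⇒walk r) ▸ e

  walk-edge : ∀ {s t vs a b} → Walk A s t vs → Consec vs a b → A b a ≡ true
  walk-edge (start ▸ e)   here      = e
  walk-edge ((w ▸ _) ▸ e) here      = e
  walk-edge (w ▸ _)       (there c) = walk-edge w c

  walk-closing : ∀ {s t vs a b z} → Walk A s t vs → Consec (vs ++ z ∷ []) a b
    → Consec vs a b ⊎ (a ≡ s × b ≡ z)
  walk-closing start         here              = inj₂ (refl , refl)
  walk-closing start         (there (there ()))
  walk-closing (start ▸ _)   here              = inj₁ here
  walk-closing ((_ ▸ _) ▸ _) here              = inj₁ here
  walk-closing (w ▸ _)       (there c) with walk-closing w c
  ... | inj₁ c′ = inj₁ (there c′)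
  ... | inj₂ p  = inj₂ p

  walk-last : ∀ {s t vs z} → Walk A s t vs → Consec (vs ++ z ∷ []) s z
  walk-last start   = here
  walk-last (w ▸ _) = there (walk-last w)

  walk-upto : ∀ {s u vs w} → Walk A s u vs → Unique vs → Any (w ≡_) vs
    → Σ (List (Fin n)) λ vs′ → Walk A s w vs′ × Unique vs′
  walk-upto start   u       (here refl) = _ , start , u
  walk-upto (p ▸ e) u       (here refl) = _ , p ▸ e , u
  walk-upto (p ▸ _) (_ ∷ u) (there w∈)  = walk-upto p u w∈

  walk-from : ∀ {s u vs w} → Walk A s u vs → Any (w ≡_) vs
    → Σ (List (Fin n)) λ vs′ → Σ (List (Fin n)) λ rest → Walk A w u vs′ × vs′ ++ rest ≡ vs
  walk-from start   (here refl) = _ , [] , start , refl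
  walk-from (p ▸ e) (here refl) = _ , _ , start , refl
  walk-from (p ▸ e) (there w∈) with walk-from p w∈
  ... | vs′ , rest , p′ , eq = _ , rest , p′ ▸ e , cong (_ ∷_) eq

  walk⇒path : ∀ {s t vs} → Walk A s t vs → Σ (List (Fin n)) λ vs′ → Walk A s t vs′ × Unique vs′
  walk⇒path start = _ , start , [] ∷ []
  walk⇒path {t = t} (w ▸ e) with walk⇒path w
  ... | vs , p , u with Any.any? (t ≟_) vs
  ... | yes t∈vs = walk-upto p u t∈vs
  ... | no  t∉vs = _ , p ▸ e , ¬Any⇒All¬ vs t∉vs ∷ u

unique-length≤n : ∀ {n} (vs : List (Fin n)) → Unique vs → length vs ≤ n
unique-length≤n {n} vs u =
  subst (length vs ≤_) (∣⊤∣≡n n) (unique⊆⇒length≤ full vs u (All.tabulate (λ _ → ∈⊤)))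

-- Reachability is decidable: v is reachable from s iff it lies in the ball
-- of radius n around s, since a shortest walk is a path with ≤ n vertices.
module Reachability {n} (A : Fin n → Fin n → Bool) (s : Fin n) where

  AdjacentTo : Subset n → Fin n → Set
  AdjacentTo B v = Σ (Fin n) λ u → u ∈ B × A u v ≡ true

  adjacentTo? : ∀ B → Decidable (AdjacentTo B)
  adjacentTo? B v = any? (λ u → u ∈? B ×-dec A u v ≟ᵇ true)

  ball : ℕ → Subset n
  ball zero    = ⁅ s ⁆
  ball (suc k) = ball k ∪ fromDec (adjacentTo? (ball k))

  ball-sound : ∀ k {v} → v ∈ ball k → Reach A s v
  ball-sound zero {v} v∈ with x∈⁅y⁆⇒x≡y s v∈
  ... | refl = here
  ball-sound (suc k) v∈ with x∈p∪q⁻ (ball k) _ v∈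
  ... | inj₁ v∈ball = ball-sound k v∈ball
  ... | inj₂ v∈next with ∈fromDec⁻ (adjacentTo? (ball k)) v∈next
  ...   | u , u∈ball , uv = step (ball-sound k u∈ball) uv

  s∈ball : ∀ k → s ∈ ball k
  s∈ball zero    = x∈⁅x⁆ s
  s∈ball (suc k) = x∈p∪q⁺ (inj₁ (s∈ball k))

  ball-complete : ∀ {v vs} → Walk A s v vs → ∀ k → length vs ≤ suc k → v ∈ ball k
  ball-complete start                   k       _         = s∈ball k
  ball-complete (start ▸ _)             zero    (s≤s ())
  ball-complete ((_ ▸ _) ▸ _)           zero    (s≤s ())
  ball-complete (_▸_ {u = u} p uv)      (suc k) (s≤s len) =
    x∈p∪q⁺ (inj₂ (∈fromDec⁺ (adjacentTo? (ball k)) (u , ball-complete p k len , uv)))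

  reach? : ∀ v → Dec (Reach A s v)
  reach? v = map′ (ball-sound n) complete (v ∈? ball n)
    where
    complete : Reach A s v → v ∈ ball n
    complete r with walk⇒path (proj₂ (reach⇒walk r))
    ... | vs , p , u = ball-complete p n (m≤n⇒m≤1+n (unique-length≤n vs u))

open Reachability using (reach?)

path⇒cycle : ∀ {n} (H : Graph n) {A : Fin n → Fin n → Bool}
  → (∀ u v → A u v ≡ true → adj H u v ≡ true)
  → ∀ {s t vs} → Walk A s t vs → Unique vs → 3 ≤ length vs → adj H s t ≡ true → IsCycle H vs
path⇒cycle H A⊆H start         _ (s≤s ()) _
path⇒cycle H A⊆H {t = t} (p ▸ e) u len st = len , u , edges
  where
  edges : ∀ a b → Consec (close (t ∷ _)) a b → adj H a b ≡ true
  edges a b c with walk-closing (p ▸ e) c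
  ... | inj₁ c′            = trans (Graph.sym H a b) (A⊆H b a (walk-edge (p ▸ e) c′))
  ... | inj₂ (refl , refl) = st

Acyclic : ∀ {n} → Graph n → Set
Acyclic H = ∀ c → ¬ IsCycle H c

Subgraph : ∀ {n} → Graph n → Graph n → Set
Subgraph H′ H = ∀ u v → adj H′ u v ≡ true → adj H u v ≡ true

cycle-mono : ∀ {n} {H′ H : Graph n} {c} → Subgraph H′ H → IsCycle H′ c → IsCycle H c
cycle-mono H′⊆H (long , u , edges) = long , u , λ a b ab → H′⊆H a b (edges a b ab)

acyclic-mono : ∀ {n} {H′ H : Graph n} → Subgraph H′ H → Acyclic H → Acyclic H′
acyclic-mono {H′ = H′} {H} H′⊆H acyclic c cyc = acyclic c (cycle-mono {H′ = H′} {H} H′⊆H cyc)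

Leaf : ∀ {n} → Graph n → Set
Leaf {n} H = Σ (Fin n) λ u → Σ (Fin n) λ w → adj H u w ≡ true × (∀ z → adj H u z ≡ true → z ≡ w)

-- A graph with an edge has a leaf or a cycle: extend a path u p … as long as
-- its end u has a neighbour other than p; when that neighbour is already on
-- the path we have closed a cycle.  The path has at most n vertices, so some
-- k > n − length bounds the number of extensions.
module _ {n} (H : Graph n) where

  private
    extend : ∀ k {s u p rest} → Walk (adj H) s u (u ∷ p ∷ rest) → Unique (u ∷ p ∷ rest)
      → n < k + length (u ∷ p ∷ rest) → Leaf H ⊎ Σ (List (Fin n)) (IsCycle H)
    extend zero    path un long = ⊥-elim (<⇒≱ long (unique-length≤n _ un))
    extend (suc k) {u = u} {p} {rest} path un long
      with any? (λ z → adj H u z ≟ᵇ true ×-dec ¬? (z ≟ p))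
    ... | no no-other = inj₁ (u , p , pu-edge , only-p)
      where
      pu-edge : adj H u p ≡ true
      pu-edge = trans (Graph.sym H u p) (walk-edge path here)
      only-p : ∀ z → adj H u z ≡ true → z ≡ p
      only-p z uz with z ≟ p
      ... | yes z≡p = z≡p
      ... | no  z≢p = ⊥-elim (no-other (z , uz , z≢p))
    ... | yes (z , uz , z≢p) with Any.any? (z ≟_) (u ∷ p ∷ rest)
    ...   | no  z∉path = extend k (path ▸ uz) (¬Any⇒All¬ _ z∉path ∷ un)
                           (subst (n <_) (sym (+-suc k _)) long)
    ...   | yes z∈path with walk-from path z∈path
    ...     | vs , tail , cyc , vs++tail = inj₂ (vs , path⇒cycle H (λ _ _ e → e) cyc
                 (prefix-unique vs (subst Unique (sym vs++tail) un))
                 (three cyc vs++tail) (trans (Graph.sym H z u) uz))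
      where
      z≢u : z ≢ u
      z≢u z≡u = adjacent⇒distinct H uz (sym z≡u)
      three : ∀ {vs} → Walk (adj H) z u vs → vs ++ tail ≡ u ∷ p ∷ rest → 3 ≤ length vs
      three start             _    = ⊥-elim (z≢u refl)
      three (start ▸ _)       refl = ⊥-elim (z≢p refl)
      three ((start ▸ _) ▸ _) _    = s≤s (s≤s (s≤s z≤n))
      three (((_ ▸ _) ▸ _) ▸ _) _  = s≤s (s≤s (s≤s z≤n))

  leaf-or-cycle : ∀ a b → adj H a b ≡ true → Leaf H ⊎ Σ (List (Fin n)) (IsCycle H)
  leaf-or-cycle a b ab = extend (suc n) (start ▸ ab) ((b≢a ∷ []) ∷ [] ∷ []) (s≤s (m≤m+n n 2))
    where
    b≢a : b ≢ a
    b≢a b≡a = adjacent⇒distinct H ab (sym b≡a)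

-- Weak duality |S| + |M| ≤ n: every edge of M has an endpoint outside the
-- independent set S, and these endpoints are distinct.

endpoints-avoid : ∀ {n} {c : Fin n} M → All (c ≢_) (endpoints M)
  → All (λ e → c ≢ proj₁ e × c ≢ proj₂ e) M
endpoints-avoid []      []                 = []
endpoints-avoid (e ∷ M) (c≢a ∷ c≢b ∷ rest) = (c≢a , c≢b) ∷ endpoints-avoid M rest

endpoint-neighbour : ∀ {n} (H : Graph n) M → All (λ e → adj H (proj₁ e) (proj₂ e) ≡ true) M
  → ∀ {z} → Any (z ≡_) (endpoints M) → Σ (Fin n) λ z′ → adj H z z′ ≡ true
endpoint-neighbour H ((a , b) ∷ M) (ab ∷ _)     (here refl)         = b , ab
endpoint-neighbour H ((a , b) ∷ M) (ab ∷ _)     (there (here refl)) = a , trans (Graph.sym H b a) ab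
endpoint-neighbour H (_ ∷ M)       (_ ∷ edges) (there (there z∈))  = endpoint-neighbour H M edges z∈

matching≤ : ∀ {n} (p : Subset n) M → Unique (endpoints M)
  → All (λ e → proj₁ e ∈ p ⊎ proj₂ e ∈ p) M → length M ≤ ∣ p ∣
matching≤ p []            _                           _            = z≤n
matching≤ p ((a , b) ∷ M) ((_ ∷ a∉M) ∷ (b∉M ∷ uniq)) (hit ∷ hits) =
  [ via a a∉M , via b b∉M ] hit
  where
  via : ∀ c → All (c ≢_) (endpoints M) → c ∈ p → suc (length M) ≤ ∣ p ∣
  via c c∉M c∈p = begin
    suc (length M) ≤⟨ s≤s (matching≤ (p - c) M uniq (All.zipWith keep (endpoints-avoid M c∉M , hits))) ⟩
    suc ∣ p - c ∣  ≡⟨ sym (∣p∣≡1+∣p-x∣ c∈p) ⟩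
    ∣ p ∣          ∎
    where
    open ≤-Reasoning
    keep : ∀ {e} → (c ≢ proj₁ e × c ≢ proj₂ e) × (proj₁ e ∈ p ⊎ proj₂ e ∈ p)
         → proj₁ e ∈ p - c ⊎ proj₂ e ∈ p - c
    keep ((c≢a′ , _) , inj₁ a′∈p) = inj₁ (∈-remove a′∈p c≢a′)
    keep ((_ , c≢b′) , inj₂ b′∈p) = inj₂ (∈-remove b′∈p c≢b′)

weak-duality : ∀ {n} (G : Graph n) {S M} → Independent (adj G) S → IsMatching G M
  → ∣ S ∣ + length M ≤ n
weak-duality {n} G {S} {M} ind (edges , uniq) = begin
  ∣ S ∣ + length M    ≤⟨ +-monoʳ-≤ ∣ S ∣ (matching≤ (∁ S) M uniq (All.map outside-endpoint edges)) ⟩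
  ∣ S ∣ + ∣ ∁ S ∣     ≡⟨ cong (∣ S ∣ +_) (∣∁p∣≡n∸∣p∣ S) ⟩
  ∣ S ∣ + (n ∸ ∣ S ∣) ≡⟨ m+[n∸m]≡n (∣p∣≤n S) ⟩
  n                   ∎
  where
  open ≤-Reasoning
  outside-endpoint : ∀ {e} → adj G (proj₁ e) (proj₂ e) ≡ true → proj₁ e ∈ ∁ S ⊎ proj₂ e ∈ ∁ S
  outside-endpoint {a , b} ab with a ∈? S | b ∈? S
  ... | no a∉S  | _       = inj₁ (x∉p⇒x∈∁p a∉S)
  ... | yes _   | no b∉S  = inj₂ (x∉p⇒x∈∁p b∉S)
  ... | yes a∈S | yes b∈S = ⊥-elim (independent⇒no-edge ind a∈S b∈S ab)

-- An independent set S and a matching M with n ≤ |S| + |M| witness that G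
-- is König–Egerváry (by weak duality both are then maximum).
record Certificate {n} (G : Graph n) : Set where
  field
    indep         : Subset n
    matching      : List (Fin n × Fin n)
    isIndependent : Independent (adj G) indep
    isMatching    : IsMatching G matching
    covers        : n ≤ ∣ indep ∣ + length matching

certificate⇒KE : ∀ {n} (G : Graph n) → Certificate G → IsKE G
certificate⇒KE G c =
  ∣ indep ∣ , length matching , (indep , maximum-indep , refl)
  , (matching , isMatching , refl , maximum-matching)
  , ≤-antisym (weak-duality G isIndependent isMatching) covers
  where
  open Certificate c
  maximum-indep : IsMaxIndep allV (adj G) indep
  maximum-indep = ((λ _ _ → tt) , isIndependent) , λ T T-ind →
    +-cancelʳ-≤ (length matching) _ _ (≤-trans (weak-duality G (proj₂ T-ind) isMatching) covers)
  maximum-matching : ∀ M → IsMatching G M → length M ≤ length matching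
  maximum-matching M M-match =
    +-cancelˡ-≤ ∣ indep ∣ _ _ (≤-trans (weak-duality G isIndependent M-match) covers)

-- Induction on the number of non-isolated
-- vertices: a forest with an edge has a leaf u with neighbour w; isolate w,
-- take a certificate (S′ , M′) of the smaller forest and return
-- ((S′ − w) ∪ {u} , uw ∷ M′).

HasNeighbour : ∀ {n} → Graph n → Fin n → Set
HasNeighbour {n} H v = Σ (Fin n) λ z → adj H v z ≡ true

hasNeighbour? : ∀ {n} (H : Graph n) → Decidable (HasNeighbour H)
hasNeighbour? H v = any? (λ z → adj H v z ≟ᵇ true)

nonIsolated : ∀ {n} → Graph n → Subset n
nonIsolated H = fromDec (hasNeighbour? H)

edgeless-certificate : ∀ {n} (H : Graph n) → (∀ a b → adj H a b ≢ true) → Certificate H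
edgeless-certificate {n} H edgeless = record
  { indep         = full
  ; matching      = []
  ; isIndependent = λ a b _ _ → ¬-not (edgeless a b)
  ; isMatching    = [] , []
  ; covers        = ≤-reflexive (sym (trans (+-identityʳ _) (∣⊤∣≡n n)))
  }

isolate-subgraph : ∀ {n} (H : Graph n) w → Subgraph (isolateGraph H w) H
isolate-subgraph H w u v e = proj₁ (isolate-edge (adj H) w u v e)

isolate-shrinks : ∀ {n} (H : Graph n) {u w} → adj H w u ≡ true
  → ∣ nonIsolated (isolateGraph H w) ∣ < ∣ nonIsolated H ∣
isolate-shrinks H {u} {w} wu =
  p⊂q⇒∣p∣<∣q∣ (shrink , w , ∈fromDec⁺ (hasNeighbour? H) (u , wu) , w-isolated)
  where
  shrink : nonIsolated (isolateGraph H w) ⊆ nonIsolated H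
  shrink v∈ with ∈fromDec⁻ (hasNeighbour? (isolateGraph H w)) v∈
  ... | z , vz = ∈fromDec⁺ (hasNeighbour? H) (z , isolate-subgraph H w _ z vz)
  w-isolated : w ∉ nonIsolated (isolateGraph H w)
  w-isolated w∈ with ∈fromDec⁻ (hasNeighbour? (isolateGraph H w)) w∈
  ... | z , wz = proj₁ (proj₂ (isolate-edge (adj H) w w z wz)) refl

leaf-extension : ∀ {n} (H : Graph n) {u w} → adj H u w ≡ true → (∀ z → adj H u z ≡ true → z ≡ w)
  → Certificate (isolateGraph H w) → Certificate H
leaf-extension {n} H {u} {w} uw only-w c = record
  { indep         = S
  ; matching      = (u , w) ∷ matching
  ; isIndependent = λ a b a∈S b∈S → ¬-not (no-edge a∈S b∈S)
  ; isMatching    = uw ∷ All.map (λ {e} → isolate-subgraph H w (proj₁ e) (proj₂ e)) edges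
                  , (u≢w ∷ ¬Any⇒All¬ _ u-unmatched) ∷ ¬Any⇒All¬ _ w-unmatched ∷ uniq
  ; covers        = bound
  }
  where
  open Certificate c
  H′ : Graph n
  H′ = isolateGraph H w
  edges : All (λ e → adj H′ (proj₁ e) (proj₂ e) ≡ true) matching
  edges = proj₁ isMatching
  uniq : Unique (endpoints matching)
  uniq = proj₂ isMatching
  S : Subset n
  S = (indep - w) ∪ ⁅ u ⁆

  u≢w : u ≢ w
  u≢w = adjacent⇒distinct H uw

  member : ∀ {x} → x ∈ S → (x ∈ indep × x ≢ w) ⊎ x ≡ u
  member {x} x∈S with x∈p∪q⁻ (indep - w) ⁅ u ⁆ x∈S
  ... | inj₁ x∈ = inj₁ (p─q⊆p indep ⁅ w ⁆ x∈ , x∉⁅y⁆⇒x≢y (x∈p─q⇒x∉q indep ⁅ w ⁆ x∈))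
  ... | inj₂ x∈ = inj₂ (x∈⁅y⁆⇒x≡y u x∈)

  w∉S : w ∉ S
  w∉S w∈S with member w∈S
  ... | inj₁ (_ , w≢w) = w≢w refl
  ... | inj₂ w≡u       = u≢w (sym w≡u)

  no-edge : ∀ {a b} → a ∈ S → b ∈ S → adj H a b ≢ true
  no-edge a∈S b∈S ab with member a∈S | member b∈S
  ... | inj₂ refl | _ = w∉S (subst (_∈ S) (only-w _ ab) b∈S)
  ... | _ | inj₂ refl = w∉S (subst (_∈ S) (only-w _ (trans (Graph.sym H u _) ab)) a∈S)
  ... | inj₁ (a∈ , a≢w) | inj₁ (b∈ , b≢w) =
    independent⇒no-edge isIndependent a∈ b∈ (isolate-keeps (adj H) w _ _ ab a≢w b≢w)

  w-unmatched : ¬ Any (w ≡_) (endpoints matching)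
  w-unmatched w∈ with endpoint-neighbour H′ matching edges w∈
  ... | z , wz = proj₁ (proj₂ (isolate-edge (adj H) w w z wz)) refl

  u-unmatched : ¬ Any (u ≡_) (endpoints matching)
  u-unmatched u∈ with endpoint-neighbour H′ matching edges u∈
  ... | z , uz with isolate-edge (adj H) w u z uz
  ...   | uz′ , _ , z≢w = z≢w (only-w z uz′)

  bound : n ≤ ∣ S ∣ + suc (length matching)
  bound = begin
    n                                  ≤⟨ covers ⟩
    ∣ indep ∣ + length matching         ≤⟨ +-monoˡ-≤ _ (∣p∣≤1+∣p-x∣ indep w) ⟩
    suc ∣ indep - w ∣ + length matching ≤⟨ +-monoˡ-≤ _ (s≤s (∣p∣≤∣p∪q∣ (indep - w) ⁅ u ⁆)) ⟩
    suc ∣ S ∣ + length matching         ≡⟨ sym (+-suc _ _) ⟩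
    ∣ S ∣ + suc (length matching)       ∎
    where open ≤-Reasoning

forest-certificate : ∀ {n} (H : Graph n) → Acyclic H → Certificate H
forest-certificate H = go H (<-wellFounded _)
  where
  go : ∀ {n} (H : Graph n) → Acc _<_ ∣ nonIsolated H ∣ → Acyclic H → Certificate H
  go H (acc smaller) acyclic with any? (λ a → any? (λ b → adj H a b ≟ᵇ true))
  ... | no no-edge = edgeless-certificate H (λ a b ab → no-edge (a , b , ab))
  ... | yes (a , b , ab) with leaf-or-cycle H a b ab
  ...   | inj₂ (c , cyc) = ⊥-elim (acyclic c cyc)
  ...   | inj₁ (u , w , uw , only-w) =
    leaf-extension H uw only-w
      (go (isolateGraph H w) (smaller (isolate-shrinks H (trans (Graph.sym H w u) uw)))
          (acyclic-mono {H′ = isolateGraph H w} {H} (isolate-subgraph H w) acyclic))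

module UnicyclicStructure {n} (G : Graph n) (C : List (Fin n))
         (unicyclic : Unicyclic G) (C-cycle : IsCycle G C) where

  cycle-edge-on-C : ∀ {c u v} → IsCycle G c → Consec (close c) u v → OnCycle C u × OnCycle C v
  cycle-edge-on-C {c} {u} {v} cyc uv with proj₁ (proj₂ (proj₂ unicyclic) c C cyc C-cycle u v) (inj₁ uv)
  ... | inj₁ uv∈C = consec-close-mem uv∈C
  ... | inj₂ vu∈C = proj₂ (consec-close-mem vu∈C) , proj₁ (consec-close-mem vu∈C)

  -- y ∉ T_x: otherwise a path from x to y in G − xy closes a cycle through xy
  y∉Tx : ∀ {x y} → ¬ OnCycle C x → adj G x y ≡ true → ¬ TxV G x y y
  y∉Tx {x} {y} x∉C xy x⇝y with walk⇒path (proj₂ (reach⇒walk x⇝y))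
  ... | _ , start , _ = adjacent⇒distinct G xy refl
  ... | _ , start ▸ e , _ with trans (sym e) (deleteEdge-removes (adj G) x y)
  ...   | ()
  y∉Tx {x} {y} x∉C xy x⇝y | vs , path@((p ▸ _) ▸ _) , uniq =
    x∉C (proj₁ (cycle-edge-on-C cycle (walk-last path)))
    where
    cycle : IsCycle G vs
    cycle = path⇒cycle G (deleteEdge⊆ (adj G) x y) path uniq (three p) xy
      where
      three : ∀ {t ws} → Walk (TxA G x y) x t ws → 3 ≤ suc (suc (length ws))
      three start   = s≤s (s≤s (s≤s z≤n))
      three (_ ▸ _) = s≤s (s≤s (s≤s z≤n))

  Tx-boundary : ∀ {x y u z} → ¬ OnCycle C x → adj G x y ≡ true
    → TxV G x y u → ¬ TxV G x y z → adj G u z ≡ true → u ≡ x × z ≡ y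
  Tx-boundary x∉C xy u∈ z∉ uz with deleteEdge-cases (adj G) _ _ _ _ uz
  ... | inj₁ kept                = ⊥-elim (z∉ (step u∈ kept))
  ... | inj₂ (inj₁ bridge)       = bridge
  ... | inj₂ (inj₂ (refl , refl)) = ⊥-elim (y∉Tx x∉C xy u∈)

  cycle-vertex : Σ (Fin n) (OnCycle C)
  cycle-vertex = first C (proj₁ C-cycle)
    where
    first : ∀ l → 3 ≤ length l → Σ (Fin n) (OnCycle l)
    first (c ∷ _) _ = c , here refl

  Located : Fin n → Set
  Located v = Σ (Fin n) λ x → Σ (Fin n) λ y →
    ¬ OnCycle C x × OnCycle C y × adj G x y ≡ true × TxV G x y v

  locate : ∀ {c v} → OnCycle C c → Reach (adj G) c v → OnCycle C v ⊎ Located v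
  locate c∈C here = inj₁ c∈C
  locate {v = v} c∈C (step {u = u} c⇝u uv) with locate c∈C c⇝u
  ... | inj₁ u∈C with Any.any? (v ≟_) C
  ...   | yes v∈C = inj₁ v∈C
  ...   | no  v∉C = inj₂ (v , u , v∉C , u∈C , trans (Graph.sym G v u) uv , here)
  locate c∈C (step c⇝u uv) | inj₂ (x , y , x∉C , y∈C , xy , u∈Tx)
    with deleteEdge-cases (adj G) x y _ _ uv
  ... | inj₁ kept                 = inj₂ (x , y , x∉C , y∈C , xy , step u∈Tx kept)
  ... | inj₂ (inj₁ (refl , refl)) = inj₁ y∈C
  ... | inj₂ (inj₂ (refl , refl)) = ⊥-elim (y∉Tx x∉C xy u∈Tx)

-- In a unicyclic graph that is not König–Egerváry, each cycle vertex y is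
-- avoided by some maximum independent set, which also avoids the neighbours
-- of y off the cycle.  Take the cycle successor y′ of y: G − yy′ is a forest,
-- so it has a certificate (R , M).  Any independent T of G with |T| ≥ |R|
-- would give a certificate of G, hence |T| < |R|; in particular R is not
-- independent in G, so y ∈ R, and R − y is the required set.
module NonKE {n} (G : Graph n) (C : List (Fin n)) (unicyclic : Unicyclic G)
         (C-cycle : IsCycle G C) (not-KE : ¬ IsKE G) where

  record Avoiding (y : Fin n) : Set where
    field
      set               : Subset n
      maximum           : IsMaxIndep allV (adj G) set
      avoids-y          : y ∉ set
      avoids-neighbours : ∀ x → ¬ OnCycle C x → adj G x y ≡ true → x ∉ set

  module _ {y y′} (yy′ : Consec (close C) y y′) where

    private
      G′ : Graph n
      G′ = deleteEdgeGraph G y y′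

    yy′-removed : adj G′ y y′ ≢ true
    yy′-removed e with trans (sym e) (deleteEdge-removes (adj G) y y′)
    ... | ()

    -- a cycle of G − yy′ would be a cycle of G, so it would contain yy′
    forest : Acyclic G′
    forest c cyc with proj₁ (proj₂ (proj₂ unicyclic) C c C-cycle
                       (cycle-mono {H′ = G′} {G} (deleteEdge⊆ (adj G) y y′) cyc) y y′) (inj₁ yy′)
    ... | inj₁ yy′∈c = yy′-removed (proj₂ (proj₂ cyc) y y′ yy′∈c)
    ... | inj₂ y′y∈c = yy′-removed (trans (Graph.sym G′ y y′) (proj₂ (proj₂ cyc) y′ y y′y∈c))

    open Certificate (forest-certificate G′ forest)
      renaming (indep to R; matching to M; isIndependent to R-indep; isMatching to M-matching)

    M-matching-G : IsMatching G M
    M-matching-G = All.map (λ {e} → deleteEdge⊆ (adj G) y y′ (proj₁ e) (proj₂ e)) (proj₁ M-matching)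
                 , proj₂ M-matching

    below-R : ∀ {T} → Independent (adj G) T → ∣ T ∣ < ∣ R ∣
    below-R {T} T-indep = ≰⇒> λ R≤T → not-KE (certificate⇒KE G record
      { indep = T ; matching = M ; isIndependent = T-indep ; isMatching = M-matching-G
      ; covers = ≤-trans covers (+-monoˡ-≤ (length M) R≤T) })

    -- R is not independent in G, so it contains y (and y′)
    y∈R : y ∈ R
    y∈R with y ∈? R
    ... | yes y∈ = y∈
    ... | no  y∉ = ⊥-elim (<-irrefl refl (below-R (independent-restore R-indep (inj₁ y∉))))

    y∉R-y : y ∉ R - y
    y∉R-y y∈ = x∈p─q⇒x∉q R ⁅ y ⁆ y∈ (x∈⁅x⁆ y)

    avoiding : Avoiding y
    avoiding = record
      { set = R - y ; maximum = R-y-max ; avoids-y = y∉R-y ; avoids-neighbours = neighbours-out }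
      where
      indep : Independent (adj G) (R - y)
      indep = independent-restore (independent-mono (p─q⊆p R ⁅ y ⁆) R-indep) (inj₁ y∉R-y)
      R-y-max : IsMaxIndep allV (adj G) (R - y)
      R-y-max = ((λ _ _ → tt) , indep) , λ T T-indep →
        ≤-pred (subst (∣ T ∣ <_) (∣p∣≡1+∣p-x∣ y∈R) (below-R (proj₂ T-indep)))
      neighbours-out : ∀ x → ¬ OnCycle C x → adj G x y ≡ true → x ∉ R - y
      neighbours-out x x∉C xy x∈ with deleteEdge-cases (adj G) y y′ x y xy
      ... | inj₁ kept            = independent⇒no-edge R-indep (p─q⊆p R ⁅ y ⁆ x∈) y∈R kept
      ... | inj₂ (inj₁ (refl , _)) = x∉C (proj₁ (consec-close-mem yy′))
      ... | inj₂ (inj₂ (refl , _)) = x∉C (proj₂ (consec-close-mem yy′))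

  avoiding-maximum : ∀ {y} → OnCycle C y → Avoiding y
  avoiding-maximum y∈C = avoiding (proj₂ (cycle-successor C y∈C))

-- For S independent in G and T
-- independent in T_x, not containing both y ∈ S and x ∈ T, the set
-- (S ─ T_x) ∪ T is independent in G.  Comparing it with S shows that S ∩ T_x
-- is maximum in T_x whenever S is maximum in G, and a set avoiding y (from
-- NonKE) lets every maximum independent set of T_x be glued into one of G.
module Bridge {n} (G : Graph n) (C : List (Fin n)) (unicyclic : Unicyclic G)
         (C-cycle : IsCycle G C) (not-KE : ¬ IsKE G)
         {x y : Fin n} (x∉C : ¬ OnCycle C x) (y∈C : OnCycle C y) (xy : adj G x y ≡ true) where

  open UnicyclicStructure G C unicyclic C-cycle
  open NonKE G C unicyclic C-cycle not-KE

  Tx : Subset n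
  Tx = fromDec (reach? (TxA G x y) x)

  restrict : ∀ {S} → Independent (adj G) S → IsIndep (TxV G x y) (TxA G x y) (S ∩ Tx)
  restrict {S} S-indep =
      (λ v v∈ → ∈fromDec⁻ (reach? (TxA G x y) x) (proj₂ (x∈p∩q⁻ S Tx v∈)))
    , independent-mono (p∩q⊆p S Tx) (independent-delete S-indep)

  glue : Subset n → Subset n → Subset n
  glue S T = (S ─ Tx) ∪ T

  module _ {S T} (S-indep : Independent (adj G) S) (T-indep : IsIndep (TxV G x y) (TxA G x y) T)
           (not-both : y ∉ S ⊎ x ∉ T) where

    private
      T⊆Tx : ∀ {v} → v ∈ T → v ∈ Tx
      T⊆Tx v∈ = ∈fromDec⁺ (reach? (TxA G x y) x) (proj₁ T-indep _ v∈)

      off-Tx : ∀ {v} → v ∈ S ─ Tx → v ∈ S × ¬ TxV G x y v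
      off-Tx v∈ = p─q⊆p S Tx v∈
                 , λ v∈Tx → x∈p─q⇒x∉q S Tx v∈ (∈fromDec⁺ (reach? (TxA G x y) x) v∈Tx)

      -- an edge from T to S ─ T_x would be the bridge with x ∈ T and y ∈ S
      cross : ∀ {a b} → a ∈ T → b ∈ S ─ Tx → adj G a b ≢ true
      cross a∈T b∈ ab with Tx-boundary x∉C xy (proj₁ T-indep _ a∈T) (proj₂ (off-Tx b∈)) ab
      ... | refl , refl = [ (λ y∉S → y∉S (proj₁ (off-Tx b∈))) , (λ x∉T → x∉T a∈T) ] not-both

      no-edge : ∀ {a b} → a ∈ glue S T → b ∈ glue S T → adj G a b ≢ true
      no-edge {a} {b} a∈ b∈ ab with x∈p∪q⁻ (S ─ Tx) T a∈ | x∈p∪q⁻ (S ─ Tx) T b∈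
      ... | inj₁ a∈S | inj₁ b∈S =
        independent⇒no-edge S-indep (proj₁ (off-Tx a∈S)) (proj₁ (off-Tx b∈S)) ab
      ... | inj₂ a∈T | inj₁ b∈S = cross a∈T b∈S ab
      ... | inj₁ a∈S | inj₂ b∈T = cross b∈T a∈S (trans (Graph.sym G b a) ab)
      ... | inj₂ a∈T | inj₂ b∈T = independent⇒no-edge
              (independent-restore (proj₂ T-indep) (inj₂ (y∉Tx x∉C xy ∘ proj₁ T-indep y))) a∈T b∈T ab

    glue-independent : Independent (adj G) (glue S T)
    glue-independent a b a∈ b∈ = ¬-not (no-edge a∈ b∈)

    ∣glue∣ : ∣ glue S T ∣ ≡ ∣ S ─ Tx ∣ + ∣ T ∣
    ∣glue∣ = ∣p∪q∣≡∣p∣+∣q∣ (S ─ Tx) T (λ v∈S v∈T → x∈p─q⇒x∉q S Tx v∈S (T⊆Tx v∈T))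

  glue-bound : ∀ {S T} → IsMaxIndep allV (adj G) S → IsIndep (TxV G x y) (TxA G x y) T
    → y ∉ S ⊎ x ∉ T → ∣ T ∣ ≤ ∣ S ∩ Tx ∣
  glue-bound {S} {T} S-max T-indep not-both = +-cancelˡ-≤ ∣ S ─ Tx ∣ _ _ (begin
    ∣ S ─ Tx ∣ + ∣ T ∣       ≡⟨ sym (∣glue∣ S-indep T-indep not-both) ⟩
    ∣ glue S T ∣             ≤⟨ proj₂ S-max _ ((λ _ _ → tt) , glue-independent S-indep T-indep not-both) ⟩
    ∣ S ∣                    ≡⟨ ∣p∣≡∣p∩q∣+∣p─q∣ S Tx ⟩
    ∣ S ∩ Tx ∣ + ∣ S ─ Tx ∣  ≡⟨ +-comm ∣ S ∩ Tx ∣ _ ⟩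
    ∣ S ─ Tx ∣ + ∣ S ∩ Tx ∣  ∎)
    where
    open ≤-Reasoning
    S-indep : Independent (adj G) S
    S-indep = proj₂ (proj₁ S-max)

  private
    open Avoiding (avoiding-maximum y∈C)
      renaming (set to S₀; maximum to S₀-max; avoids-y to y∉S₀; avoids-neighbours to off-cycle∉S₀)

    x∉S₀ : x ∉ S₀
    x∉S₀ = off-cycle∉S₀ x x∉C xy

    T₀ : Subset n
    T₀ = S₀ ∩ Tx

  T₀-max : IsMaxIndep (TxV G x y) (TxA G x y) T₀
  T₀-max = restrict (proj₂ (proj₁ S₀-max)) , λ T T-indep → glue-bound S₀-max T-indep (inj₁ y∉S₀)

  restrict-maximum : ∀ {S} → IsMaxIndep allV (adj G) S → IsMaxIndep (TxV G x y) (TxA G x y) (S ∩ Tx)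
  restrict-maximum S-max = restrict (proj₂ (proj₁ S-max)) , λ T T-indep →
    ≤-trans (proj₂ T₀-max T T-indep)
            (glue-bound S-max (proj₁ T₀-max) (inj₂ (x∉S₀ ∘ proj₁ ∘ x∈p∩q⁻ S₀ Tx)))

  glue-maximum : ∀ {T} → IsMaxIndep (TxV G x y) (TxA G x y) T → IsMaxIndep allV (adj G) (glue S₀ T)
  glue-maximum {T} T-max = ((λ _ _ → tt) , glue-independent S₀-indep T-indep (inj₁ y∉S₀)) , λ U U-indep →
    ≤-trans (proj₂ S₀-max U U-indep) (begin
      ∣ S₀ ∣                   ≡⟨ ∣p∣≡∣p∩q∣+∣p─q∣ S₀ Tx ⟩
      ∣ T₀ ∣ + ∣ S₀ ─ Tx ∣     ≤⟨ +-monoˡ-≤ ∣ S₀ ─ Tx ∣ (proj₂ T-max T₀ (proj₁ T₀-max)) ⟩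
      ∣ T ∣ + ∣ S₀ ─ Tx ∣      ≡⟨ +-comm ∣ T ∣ _ ⟩
      ∣ S₀ ─ Tx ∣ + ∣ T ∣      ≡⟨ sym (∣glue∣ S₀-indep T-indep (inj₁ y∉S₀)) ⟩
      ∣ glue S₀ T ∣            ∎)
    where
    open ≤-Reasoning
    S₀-indep : Independent (adj G) S₀
    S₀-indep = proj₂ (proj₁ S₀-max)
    T-indep : IsIndep (TxV G x y) (TxA G x y) T
    T-indep = proj₁ T-max

  -- core(T_x) ⊆ core(G): every maximum S of G traces to a maximum set of T_x
  core-Tx⊆core-G : ∀ v → InCore (TxV G x y) (TxA G x y) v → InCore allV (adj G) v
  core-Tx⊆core-G v v∈core S S-max = proj₁ (x∈p∩q⁻ S Tx (v∈core (S ∩ Tx) (restrict-maximum S-max)))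

  -- core(G) ∩ T_x ⊆ core(T_x): T is the trace on T_x of the maximum set glue S₀ T
  core-G⊆core-Tx : ∀ v → TxV G x y v → InCore allV (adj G) v → InCore (TxV G x y) (TxA G x y) v
  core-G⊆core-Tx v v∈Tx v∈core T T-max with x∈p∪q⁻ (S₀ ─ Tx) T (v∈core (glue S₀ T) (glue-maximum T-max))
  ... | inj₁ v∈S₀─Tx = ⊥-elim (x∈p─q⇒x∉q S₀ Tx v∈S₀─Tx (∈fromDec⁺ (reach? (TxA G x y) x) v∈Tx))
  ... | inj₂ v∈T     = v∈T

InBranchCore : ∀ {n} → Graph n → List (Fin n) → Fin n → Set
InBranchCore {n} G C v = Σ (Fin n) λ x → Σ (Fin n) λ y → InN1 G C x × OnCycle C y
                       × adj G x y ≡ true × InCore (TxV G x y) (TxA G x y) v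

module _ {n} (G : Graph n) (C : List (Fin n)) (unicyclic : Unicyclic G)
         (C-cycle : IsCycle G C) (not-KE : ¬ IsKE G) where

  open UnicyclicStructure G C unicyclic C-cycle
  open NonKE G C unicyclic C-cycle not-KE

  -- a vertex of core(G) is not on C (some maximum set avoids it), so it lies
  -- in some T_x, and there it lies in core(T_x)
  core⊆branch-cores : ∀ v → InCore allV (adj G) v → InBranchCore G C v
  core⊆branch-cores v v∈core with locate (proj₂ cycle-vertex) (proj₁ unicyclic (proj₁ cycle-vertex) v)
  ... | inj₁ v∈C = ⊥-elim (avoids-y (v∈core set maximum))
    where open Avoiding (avoiding-maximum v∈C)
  ... | inj₂ (x , y , x∉C , y∈C , xy , v∈Tx) =
    x , y , (x∉C , y , y∈C , xy) , y∈C , xy ,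
    Bridge.core-G⊆core-Tx G C unicyclic C-cycle not-KE x∉C y∈C xy v v∈Tx v∈core

  branch-cores⊆core : ∀ v → InBranchCore G C v → InCore allV (adj G) v
  branch-cores⊆core v (x , y , (x∉C , _) , y∈C , xy , v∈core) =
    Bridge.core-Tx⊆core-G G C unicyclic C-cycle not-KE x∉C y∈C xy v v∈core

theorem2p10 : ∀ {n} (G : Graph n) (C : List (Fin n))
    → Unicyclic G → IsCycle G C → ¬ IsKE G
    → ∀ v → (InCore allV (adj G) v
               → Σ (Fin n) λ x → Σ (Fin n) λ y → InN1 G C x × OnCycle C y
                   × adj G x y ≡ true × InCore (TxV G x y) (TxA G x y) v)
          × ((Σ (Fin n) λ x → Σ (Fin n) λ y → InN1 G C x × OnCycle C y
                   × adj G x y ≡ true × InCore (TxV G x y) (TxA G x y) v)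
               → InCore allV (adj G) v)
theorem2p10 G C unicyclic C-cycle not-KE v =
  core⊆branch-cores G C unicyclic C-cycle not-KE v , branch-cores⊆core G C unicyclic C-cycle not-KE v
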